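{- Let $\ell,n\in\mathbb N$ with $\ell\ge3$, and let $\zeta\in(0,1]$. Let $t=\lceil 2\ell^2/\zeta\rceil$ and suppose $n\zeta^\ell\ge16t$. Then there exists a sequence $(L_i)_{i\in[n]}$ of $\ell$-element subsets of $[t]=\{1,\dots,t\}$ such that, for every $Z\subseteq[t]$ with $|Z|=zt\ge\zeta t$, we have $|\{i\in[n]:L_i\subseteq Z\}|\ge nz^\ell/4$.
   Formalization: The parameter ζ ranges over the rationals in the interval (0,1]. -}

module Defs where

open import Data.Nat as ℕ using (ℕ; zero; suc)
open import Data.Integer as ℤ using (ℤ; +_)
open import Data.Rational as ℚ using (ℚ; 1ℚ; _*_; _÷_; NonZero; ceiling)
open import Data.Bool using (Bool)
open import Data.Vec using (tabulate)
open import Data.Fin using (Fin)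
open import Data.Fin.Subset using (Subset; _⊆_)
open import Data.Fin.Subset.Properties using (_⊆?_)
open import Relation.Nullary.Decidable using (does)

infixr 8 _^_
_^_ : ℚ → ℕ → ℚ
p ^ zero  = 1ℚ
p ^ suc k = p * (p ^ k)

toℚ : ℕ → ℚ
toℚ n = (+ n) ℚ./ 1

-- t = ⌈ 2ℓ² / ζ ⌉  (as a natural number; ζ > 0 so the ceiling is positive)
tOf : (ℓ : ℕ) (ζ : ℚ) → .{{_ : NonZero ζ}} → ℕ
tOf ℓ ζ = ℤ.∣ ceiling (toℚ (2 ℕ.* ℓ ℕ.* ℓ) ÷ ζ) ∣

containedIn : {n t : ℕ} → (Fin n → Subset t) → Subset t → Subset n
containedIn L Z = tabulate (λ i → does (L i ⊆? Z))

module Submission where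

-- Draw n
-- ℓ-subsets L₁, …, Lₙ of [t] uniformly and independently.  For a set Z ⊆ [t] of size k ≥ ζt the
-- number of i with Lᵢ ⊆ Z is a sum of n independent indicators of mean K/N, where N = t C ℓ and
-- K = k C ℓ ≥ (3/4)(k/t)^ℓ N because 2ℓ² ≤ k (BinomialEstimate).  An exponential-moment bound
-- (SequenceSums.lower-tail) with the weight 2 per hit and the estimate of Decay show that fewer
-- than n(k/t)^ℓ/4 hits happen with probability below 2^(-t); a union bound over the 2^t sets Z
-- leaves a sequence that works for all of them at once (Counting.good-sequence).
--
-- Probabilities are replaced by exact counts: sums over the (t C ℓ)^n sequences of ℓ-subsets
-- (SubsetSums, SequenceSums), so the whole argument is natural-number arithmetic.

open import Data.Nat as ℕ using (ℕ; _≥_)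

module SubsetSums where

  open import Data.Nat
  open import Data.Nat.Properties
  open import Data.Nat.Combinatorics using (_C_; nCk+nC[k+1]≡[n+1]C[k+1])
  open import Data.Bool using (true; false; if_then_else_)
  open import Data.Vec using ([]; _∷_)
  open import Data.Fin.Subset using (Subset; inside; outside; ∣_∣; ⊥)
  open import Data.Fin.Subset.Properties using (_⊆?_)
  open import Data.Product using (Σ; _×_; _,_)
  open import Data.Sum using (_⊎_; inj₁; inj₂)
  open import Relation.Nullary using (Dec; yes; no; does; ¬_; contradiction)
  open import Relation.Binary.PropositionalEquality
  open import Algebra.Properties.CommutativeSemigroup +-commutativeSemigroup
    using () renaming (interchange to +-interchange)

  indicator : ∀ {p} {P : Set p} → Dec P → ℕ
  indicator d = if does d then 1 else 0

  indicator-zero : ∀ {p} {P : Set p} (d : Dec P) → indicator d ≡ 0 → ¬ P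
  indicator-zero (yes _) () _
  indicator-zero (no ¬p) _  = ¬p

  sumChoose : (t ℓ : ℕ) → (Subset t → ℕ) → ℕ
  sumChoose zero    zero    f = f []
  sumChoose zero    (suc ℓ) f = 0
  sumChoose (suc t) zero    f = sumChoose t zero (λ x → f (outside ∷ x))
  sumChoose (suc t) (suc ℓ) f =
    sumChoose t (suc ℓ) (λ x → f (outside ∷ x)) + sumChoose t ℓ (λ x → f (inside ∷ x))

  sumChoose-cong : ∀ t ℓ {f g : Subset t → ℕ} → (∀ x → f x ≡ g x) →
                   sumChoose t ℓ f ≡ sumChoose t ℓ g
  sumChoose-cong zero    zero    e = e []
  sumChoose-cong zero    (suc ℓ) e = refl
  sumChoose-cong (suc t) zero    e = sumChoose-cong t zero (λ x → e _)
  sumChoose-cong (suc t) (suc ℓ) e =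
    cong₂ _+_ (sumChoose-cong t (suc ℓ) (λ x → e _)) (sumChoose-cong t ℓ (λ x → e _))

  sumChoose-mono : ∀ t ℓ {f g : Subset t → ℕ} → (∀ x → f x ≤ g x) →
                   sumChoose t ℓ f ≤ sumChoose t ℓ g
  sumChoose-mono zero    zero    e = e []
  sumChoose-mono zero    (suc ℓ) e = ≤-refl
  sumChoose-mono (suc t) zero    e = sumChoose-mono t zero (λ x → e _)
  sumChoose-mono (suc t) (suc ℓ) e =
    +-mono-≤ (sumChoose-mono t (suc ℓ) (λ x → e _)) (sumChoose-mono t ℓ (λ x → e _))

  sumChoose-+ : ∀ t ℓ (f g : Subset t → ℕ) →
                sumChoose t ℓ (λ x → f x + g x) ≡ sumChoose t ℓ f + sumChoose t ℓ g
  sumChoose-+ zero    zero    f g = refl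
  sumChoose-+ zero    (suc ℓ) f g = refl
  sumChoose-+ (suc t) zero    f g = sumChoose-+ t zero _ _
  sumChoose-+ (suc t) (suc ℓ) f g =
    trans (cong₂ _+_ (sumChoose-+ t (suc ℓ) (λ x → f (outside ∷ x)) (λ x → g (outside ∷ x)))
                     (sumChoose-+ t ℓ (λ x → f (inside ∷ x)) (λ x → g (inside ∷ x))))
          (+-interchange (sumChoose t (suc ℓ) (λ x → f (outside ∷ x))) _ _ _)

  sumChoose-* : ∀ t ℓ c (f : Subset t → ℕ) →
                sumChoose t ℓ (λ x → c * f x) ≡ c * sumChoose t ℓ f
  sumChoose-* zero    zero    c f = refl
  sumChoose-* zero    (suc ℓ) c f = sym (*-zeroʳ c)
  sumChoose-* (suc t) zero    c f = sumChoose-* t zero c _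
  sumChoose-* (suc t) (suc ℓ) c f =
    trans (cong₂ _+_ (sumChoose-* t (suc ℓ) c _) (sumChoose-* t ℓ c _)) (sym (*-distribˡ-+ c _ _))

  sumChoose-0 : ∀ t ℓ → sumChoose t ℓ (λ _ → 0) ≡ 0
  sumChoose-0 t ℓ = sumChoose-* t ℓ 0 (λ _ → 0)

  sumChoose-1 : ∀ t ℓ → sumChoose t ℓ (λ _ → 1) ≡ t C ℓ
  sumChoose-1 zero    zero    = refl
  sumChoose-1 zero    (suc ℓ) = refl
  sumChoose-1 (suc t) zero    = sumChoose-1 t zero
  sumChoose-1 (suc t) (suc ℓ) =
    trans (cong₂ _+_ (sumChoose-1 t (suc ℓ)) (sumChoose-1 t ℓ))
          (trans (+-comm (t C suc ℓ) (t C ℓ)) (nCk+nC[k+1]≡[n+1]C[k+1] t ℓ))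

  sumChoose-⊆ : ∀ t ℓ (Z : Subset t) → sumChoose t ℓ (λ x → indicator (x ⊆? Z)) ≡ ∣ Z ∣ C ℓ
  sumChoose-⊆ zero    zero    []            = refl
  sumChoose-⊆ zero    (suc ℓ) []            = refl
  sumChoose-⊆ (suc t) zero    (_ ∷ Z)       = sumChoose-⊆ t zero Z
  sumChoose-⊆ (suc t) (suc ℓ) (outside ∷ Z) =
    trans (cong₂ _+_ (sumChoose-⊆ t (suc ℓ) Z) (sumChoose-0 t ℓ)) (+-identityʳ _)
  sumChoose-⊆ (suc t) (suc ℓ) (inside ∷ Z)  =
    trans (cong₂ _+_ (sumChoose-⊆ t (suc ℓ) Z) (sumChoose-⊆ t ℓ Z))
          (trans (+-comm (∣ Z ∣ C suc ℓ) (∣ Z ∣ C ℓ)) (nCk+nC[k+1]≡[n+1]C[k+1] ∣ Z ∣ ℓ))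

  -- Constructive comparison of sums: if at every ℓ-subset either P holds or a ≤ g, then either
  -- P has an ℓ-subset witness or Σ a ≤ Σ g.  This is how a witness is extracted from a count.
  sumChoose-witness : ∀ t ℓ (P : Subset t → Set) (a g : Subset t → ℕ) →
    (∀ x → ∣ x ∣ ≡ ℓ → P x ⊎ a x ≤ g x) →
    (Σ (Subset t) λ x → ∣ x ∣ ≡ ℓ × P x) ⊎ sumChoose t ℓ a ≤ sumChoose t ℓ g
  sumChoose-witness zero zero P a g h with h [] refl
  ... | inj₁ p   = inj₁ ([] , refl , p)
  ... | inj₂ a≤g = inj₂ a≤g
  sumChoose-witness zero (suc ℓ) P a g h = inj₂ z≤n
  sumChoose-witness (suc t) zero P a g h
    with sumChoose-witness t zero _ _ _ (λ x → h (outside ∷ x))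
  ... | inj₁ (x , ∣x∣ , p) = inj₁ (outside ∷ x , ∣x∣ , p)
  ... | inj₂ le           = inj₂ le
  sumChoose-witness (suc t) (suc ℓ) P a g h
    with sumChoose-witness t (suc ℓ) _ _ _ (λ x → h (outside ∷ x))
       | sumChoose-witness t ℓ _ _ _ (λ x e → h (inside ∷ x) (cong suc e))
  ... | inj₁ (x , ∣x∣ , p) | _                  = inj₁ (outside ∷ x , ∣x∣ , p)
  ... | inj₂ _             | inj₁ (x , ∣x∣ , p) = inj₁ (inside ∷ x , cong suc ∣x∣ , p)
  ... | inj₂ le₁           | inj₂ le₂           = inj₂ (+-mono-≤ le₁ le₂)

  sumAll : (m : ℕ) → (Subset m → ℕ) → ℕ
  sumAll zero    f = f []
  sumAll (suc m) f = sumAll m (λ x → f (inside ∷ x)) + sumAll m (λ x → f (outside ∷ x))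

  sumAll-mono : ∀ m {f g : Subset m → ℕ} → (∀ x → f x ≤ g x) → sumAll m f ≤ sumAll m g
  sumAll-mono zero    e = e []
  sumAll-mono (suc m) e = +-mono-≤ (sumAll-mono m (λ x → e _)) (sumAll-mono m (λ x → e _))

  sumAll-* : ∀ m c (f : Subset m → ℕ) → sumAll m (λ x → c * f x) ≡ c * sumAll m f
  sumAll-* zero    c f = refl
  sumAll-* (suc m) c f =
    trans (cong₂ _+_ (sumAll-* m c _) (sumAll-* m c _)) (sym (*-distribˡ-+ c _ _))

  sumAll-const : ∀ m c → sumAll m (λ _ → c) ≡ 2 ^ m * c
  sumAll-const zero    c = sym (+-identityʳ c)
  sumAll-const (suc m) c = begin
    sumAll m (λ _ → c) + sumAll m (λ _ → c) ≡⟨ cong₂ _+_ (sumAll-const m c) (sumAll-const m c) ⟩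
    2 ^ m * c + 2 ^ m * c                   ≡⟨ sym (*-distribʳ-+ c (2 ^ m) (2 ^ m)) ⟩
    (2 ^ m + 2 ^ m) * c                     ≡⟨ cong (λ u → (2 ^ m + u) * c) (sym (+-identityʳ _)) ⟩
    2 ^ suc m * c                           ∎
    where open ≡-Reasoning

  sumAll-zero : ∀ m (f : Subset m → ℕ) → sumAll m f ≡ 0 → ∀ x → f x ≡ 0
  sumAll-zero zero    f e []            = e
  sumAll-zero (suc m) f e (inside ∷ x)  = sumAll-zero m _ (m+n≡0⇒m≡0 _ e) x
  sumAll-zero (suc m) f e (outside ∷ x) = sumAll-zero m _ (m+n≡0⇒n≡0 (sumAll m _) e) x

  sumAll-union : ∀ m M (f : Subset m → ℕ) → (∀ x → 2 ^ m * f x < M) → sumAll m f < M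
  sumAll-union m zero    f h = contradiction (h ⊥) λ ()
  sumAll-union m (suc M) f h = s≤s (*-cancelˡ-≤ (2 ^ m) {{m^n≢0 2 m}} (begin
    2 ^ m * sumAll m f             ≡⟨ sym (sumAll-* m (2 ^ m) f) ⟩
    sumAll m (λ x → 2 ^ m * f x)  ≤⟨ sumAll-mono m (λ x → s≤s⁻¹ (h x)) ⟩
    sumAll m (λ _ → M)            ≡⟨ sumAll-const m M ⟩
    2 ^ m * M                     ∎))
    where open ≤-Reasoning

  -- The weight 2 - [x ⊆ Z]: the exponential-moment weight of one draw in the tail bound.
  penalty : ∀ {t} → Subset t → Subset t → ℕ
  penalty Z x = if does (x ⊆? Z) then 1 else 2

  penalty-+-indicator : ∀ {t} (Z x : Subset t) → penalty Z x + indicator (x ⊆? Z) ≡ 2 * 1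
  penalty-+-indicator Z x with does (x ⊆? Z)
  ... | true  = refl
  ... | false = refl

  penalty-total : ∀ t ℓ (Z : Subset t) →
    sumChoose t ℓ (penalty Z) + ∣ Z ∣ C ℓ ≡ 2 * (t C ℓ)
  penalty-total t ℓ Z = begin
    sumChoose t ℓ (penalty Z) + ∣ Z ∣ C ℓ
      ≡⟨ cong (sumChoose t ℓ (penalty Z) +_) (sym (sumChoose-⊆ t ℓ Z)) ⟩
    sumChoose t ℓ (penalty Z) + sumChoose t ℓ (λ x → indicator (x ⊆? Z))
      ≡⟨ sym (sumChoose-+ t ℓ (penalty Z) _) ⟩
    sumChoose t ℓ (λ x → penalty Z x + indicator (x ⊆? Z))
      ≡⟨ sumChoose-cong t ℓ (penalty-+-indicator Z) ⟩
    sumChoose t ℓ (λ _ → 2 * 1)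
      ≡⟨ sumChoose-* t ℓ 2 (λ _ → 1) ⟩
    2 * sumChoose t ℓ (λ _ → 1)
      ≡⟨ cong (2 *_) (sumChoose-1 t ℓ) ⟩
    2 * (t C ℓ) ∎
    where open ≡-Reasoning

  choose-⊆-≤ : ∀ t ℓ (Z : Subset t) → ∣ Z ∣ C ℓ ≤ t C ℓ
  choose-⊆-≤ t ℓ Z = begin
    ∣ Z ∣ C ℓ                                  ≡⟨ sym (sumChoose-⊆ t ℓ Z) ⟩
    sumChoose t ℓ (λ x → indicator (x ⊆? Z))  ≤⟨ sumChoose-mono t ℓ (λ x → indicator≤1 (x ⊆? Z)) ⟩
    sumChoose t ℓ (λ _ → 1)                   ≡⟨ sumChoose-1 t ℓ ⟩
    t C ℓ                                     ∎
    where
    open ≤-Reasoning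
    indicator≤1 : ∀ {p} {P : Set p} (d : Dec P) → indicator d ≤ 1
    indicator≤1 (yes _) = ≤-refl
    indicator≤1 (no _)  = z≤n

module SequenceSums (t ℓ : ℕ) where

  open import Data.Nat
  open import Data.Nat.Properties
  open import Data.Nat.Combinatorics using (_C_)
  open import Data.Bool using (true; false; if_then_else_)
  open import Data.Vec using (Vec; []; _∷_; lookup)
  open import Data.Fin using (zero; suc)
  open import Data.Fin.Subset using (Subset; inside; outside; ∣_∣)
  open import Data.Fin.Subset.Properties using (_⊆?_)
  open import Data.Product using (Σ; _×_; _,_)
  open import Data.Sum using (_⊎_; inj₁; inj₂)
  open import Relation.Nullary using (Dec; yes; no; does; contradiction)
  open import Relation.Binary.PropositionalEquality
  open import Defs using (containedIn)
  open import Algebra.Properties.CommutativeSemigroup *-commutativeSemigroup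
    using () renaming (interchange to *-interchange)
  open SubsetSums

  -- Σ over sequences v of length n of ℓ-subsets of [t]: the sample space of n independent
  -- uniform draws, counted with multiplicity.
  sumSeq : (n : ℕ) → (Vec (Subset t) n → ℕ) → ℕ
  sumSeq zero    f = f []
  sumSeq (suc n) f = sumChoose t ℓ (λ x → sumSeq n (λ v → f (x ∷ v)))

  sumSeq-mono : ∀ n {f g : Vec (Subset t) n → ℕ} → (∀ v → f v ≤ g v) → sumSeq n f ≤ sumSeq n g
  sumSeq-mono zero    e = e []
  sumSeq-mono (suc n) e = sumChoose-mono t ℓ (λ x → sumSeq-mono n (λ v → e _))

  sumSeq-+ : ∀ n (f g : Vec (Subset t) n → ℕ) →
             sumSeq n (λ v → f v + g v) ≡ sumSeq n f + sumSeq n g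
  sumSeq-+ zero    f g = refl
  sumSeq-+ (suc n) f g =
    trans (sumChoose-cong t ℓ (λ x → sumSeq-+ n _ _)) (sumChoose-+ t ℓ _ _)

  sumSeq-* : ∀ n c (f : Vec (Subset t) n → ℕ) → sumSeq n (λ v → c * f v) ≡ c * sumSeq n f
  sumSeq-* zero    c f = refl
  sumSeq-* (suc n) c f =
    trans (sumChoose-cong t ℓ (λ x → sumSeq-* n c _)) (sumChoose-* t ℓ c _)

  sumSeq-sumAll : ∀ n m (h : Vec (Subset t) n → Subset m → ℕ) →
    sumSeq n (λ v → sumAll m (h v)) ≡ sumAll m (λ Z → sumSeq n (λ v → h v Z))
  sumSeq-sumAll n zero    h = refl
  sumSeq-sumAll n (suc m) h = trans (sumSeq-+ n _ _)
    (cong₂ _+_ (sumSeq-sumAll n m (λ v x → h v (inside ∷ x)))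
               (sumSeq-sumAll n m (λ v x → h v (outside ∷ x))))

  sumSeq-1 : ∀ n → sumSeq n (λ _ → 1) ≡ (t C ℓ) ^ n
  sumSeq-1 zero    = refl
  sumSeq-1 (suc n) = begin
    sumChoose t ℓ (λ _ → sumSeq n (λ _ → 1))
      ≡⟨ sumChoose-cong t ℓ (λ _ → sym (*-identityʳ _)) ⟩
    sumChoose t ℓ (λ _ → sumSeq n (λ _ → 1) * 1)
      ≡⟨ sumChoose-* t ℓ (sumSeq n (λ _ → 1)) (λ _ → 1) ⟩
    sumSeq n (λ _ → 1) * sumChoose t ℓ (λ _ → 1)
      ≡⟨ cong₂ _*_ (sumSeq-1 n) (sumChoose-1 t ℓ) ⟩
    (t C ℓ) ^ n * (t C ℓ)
      ≡⟨ *-comm _ (t C ℓ) ⟩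
    (t C ℓ) ^ suc n ∎
    where open ≡-Reasoning

  product : ∀ {n} → (Subset t → ℕ) → Vec (Subset t) n → ℕ
  product w []      = 1
  product w (x ∷ v) = w x * product w v

  sumSeq-product : ∀ n (w : Subset t → ℕ) → sumSeq n (product w) ≡ sumChoose t ℓ w ^ n
  sumSeq-product zero    w = refl
  sumSeq-product (suc n) w = begin
    sumChoose t ℓ (λ x → sumSeq n (λ v → w x * product w v))
      ≡⟨ sumChoose-cong t ℓ (λ x → sumSeq-* n (w x) (product w)) ⟩
    sumChoose t ℓ (λ x → w x * sumSeq n (product w))
      ≡⟨ sumChoose-cong t ℓ (λ x → *-comm (w x) _) ⟩
    sumChoose t ℓ (λ x → sumSeq n (product w) * w x)
      ≡⟨ sumChoose-* t ℓ (sumSeq n (product w)) w ⟩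
    sumSeq n (product w) * sumChoose t ℓ w
      ≡⟨ cong (_* sumChoose t ℓ w) (sumSeq-product n w) ⟩
    sumChoose t ℓ w ^ n * sumChoose t ℓ w
      ≡⟨ *-comm _ (sumChoose t ℓ w) ⟩
    sumChoose t ℓ w ^ suc n ∎
    where open ≡-Reasoning

  Valid : ∀ {n} → Vec (Subset t) n → Set
  Valid v = ∀ i → ∣ lookup v i ∣ ≡ ℓ

  sumSeq-witness : ∀ n (f : Vec (Subset t) n → ℕ) →
    (Σ (Vec (Subset t) n) λ v → Valid v × f v ≡ 0) ⊎ sumSeq n (λ _ → 1) ≤ sumSeq n f
  sumSeq-witness zero f with f [] in f[]
  ... | zero  = inj₁ ([] , (λ ()) , f[])
  ... | suc _ = inj₂ (s≤s z≤n)
  sumSeq-witness (suc n) f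
    with sumChoose-witness t ℓ _ _ _ (λ x _ → sumSeq-witness n (λ v → f (x ∷ v)))
  ... | inj₁ (x , ∣x∣ , (v , valid , fv)) = inj₁ (x ∷ v , valid′ , fv)
    where
    valid′ : Valid (x ∷ v)
    valid′ zero    = ∣x∣
    valid′ (suc i) = valid i
  ... | inj₂ le = inj₂ le

  vanishes-somewhere : ∀ n (f : Vec (Subset t) n → ℕ) → sumSeq n f < (t C ℓ) ^ n →
    Σ (Vec (Subset t) n) λ v → Valid v × f v ≡ 0
  vanishes-somewhere n f small with sumSeq-witness n f
  ... | inj₁ witness = witness
  ... | inj₂ large   = contradiction (≤-trans (≤-reflexive (sym (sumSeq-1 n))) large) (<⇒≱ small)

  hits : ∀ {n} → Subset t → Vec (Subset t) n → ℕ
  hits Z []      = 0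
  hits Z (x ∷ v) = indicator (x ⊆? Z) + hits Z v

  hits-containedIn : ∀ {n} (Z : Subset t) (v : Vec (Subset t) n) →
                     ∣ containedIn (lookup v) Z ∣ ≡ hits Z v
  hits-containedIn Z []      = refl
  hits-containedIn Z (x ∷ v) with does (x ⊆? Z)
  ... | true  = cong suc (hits-containedIn Z v)
  ... | false = hits-containedIn Z v

  -- product (penalty Z) v · 2^(hits Z v) = 2^n, since each draw contributes exactly a factor 2:
  -- the penalty weight is an exponential moment of the number of misses.
  product-penalty : ∀ {n} (Z : Subset t) (v : Vec (Subset t) n) →
                    product (penalty Z) v * 2 ^ hits Z v ≡ 2 ^ n
  product-penalty Z []      = refl
  product-penalty {suc n} Z (x ∷ v) = begin
    (penalty Z x * product (penalty Z) v) * 2 ^ (indicator (x ⊆? Z) + hits Z v)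
      ≡⟨ cong (penalty Z x * product (penalty Z) v *_) (^-distribˡ-+-* 2 (indicator (x ⊆? Z)) _) ⟩
    (penalty Z x * product (penalty Z) v) * (2 ^ indicator (x ⊆? Z) * 2 ^ hits Z v)
      ≡⟨ *-interchange (penalty Z x) _ _ _ ⟩
    (penalty Z x * 2 ^ indicator (x ⊆? Z)) * (product (penalty Z) v * 2 ^ hits Z v)
      ≡⟨ cong₂ _*_ (one-draw (does (x ⊆? Z))) (product-penalty Z v) ⟩
    2 ^ suc n ∎
    where
    open ≡-Reasoning
    one-draw : ∀ b → (if b then 1 else 2) * 2 ^ (if b then 1 else 0) ≡ 2
    one-draw true  = refl
    one-draw false = refl

  lower-tail : ∀ n M (Z : Subset t) {Low : Vec (Subset t) n → Set}
    (low? : ∀ v → Dec (Low v)) → (∀ v → Low v → hits Z v ≤ M) →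
    2 ^ n * sumSeq n (λ v → indicator (low? v)) ≤ 2 ^ M * sumChoose t ℓ (penalty Z) ^ n
  lower-tail n M Z low? few = begin
    2 ^ n * sumSeq n (λ v → indicator (low? v))     ≡⟨ sym (sumSeq-* n (2 ^ n) _) ⟩
    sumSeq n (λ v → 2 ^ n * indicator (low? v))     ≤⟨ sumSeq-mono n pointwise ⟩
    sumSeq n (λ v → 2 ^ M * product (penalty Z) v)  ≡⟨ sumSeq-* n (2 ^ M) _ ⟩
    2 ^ M * sumSeq n (product (penalty Z))
      ≡⟨ cong (2 ^ M *_) (sumSeq-product n (penalty Z)) ⟩
    2 ^ M * sumChoose t ℓ (penalty Z) ^ n           ∎
    where
    open ≤-Reasoning
    -- Markov's inequality for the weight 2^(M - hits), one sequence at a time.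
    pointwise : ∀ v → 2 ^ n * indicator (low? v) ≤ 2 ^ M * product (penalty Z) v
    pointwise v with low? v
    ... | no _    = ≤-trans (≤-reflexive (*-zeroʳ (2 ^ n))) z≤n
    ... | yes low = begin
      2 ^ n * 1                             ≡⟨ *-identityʳ _ ⟩
      2 ^ n                                 ≡⟨ sym (product-penalty Z v) ⟩
      product (penalty Z) v * 2 ^ hits Z v
        ≤⟨ *-monoʳ-≤ (product (penalty Z) v) (^-monoʳ-≤ 2 (few v low)) ⟩
      product (penalty Z) v * 2 ^ M         ≡⟨ *-comm _ (2 ^ M) ⟩
      2 ^ M * product (penalty Z) v         ∎

module BinomialEstimate where

  open import Data.Nat
  open import Data.Nat.Properties
  open import Data.Nat.Combinatorics using (_C_; nCk≡nPk/k!; nCk+nC[k+1]≡[n+1]C[k+1])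
  open import Data.Nat.Combinatorics.Base using (_P_; _P′_)
  open import Data.Nat.Combinatorics.Specification using (k!∣nP′k)
  open import Data.Nat.DivMod using (m/n*n≡m)
  open import Data.Nat.Tactic.RingSolver using (solve-∀)
  open import Data.Bool using (true)
  open import Relation.Binary.PropositionalEquality

  ℓ≤2ℓℓ : ∀ ℓ → ℓ ≤ 2 * ℓ * ℓ
  ℓ≤2ℓℓ zero      = z≤n
  ℓ≤2ℓℓ ℓ@(suc _) = begin
    ℓ           ≤⟨ m≤m*n ℓ ℓ ⟩
    ℓ * ℓ       ≤⟨ m≤n*m (ℓ * ℓ) 2 ⟩
    2 * (ℓ * ℓ) ≡⟨ sym (*-assoc 2 ℓ ℓ) ⟩
    2 * ℓ * ℓ   ∎
    where open ≤-Reasoning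

  choose*factorial : ∀ {k n} → k ≤ n → (n C k) * k ! ≡ n P′ k
  choose*factorial {k} {n} k≤n = begin
    (n C k) * k !             ≡⟨ cong (_* k !) (nCk≡nPk/k! k≤n) ⟩
    ((n P k) / k !) * k !     ≡⟨ m/n*n≡m (subst (k ! ∣_) (sym P≡P′) (k!∣nP′k k≤n)) ⟩
    n P k                     ≡⟨ P≡P′ ⟩
    n P′ k                    ∎
    where
    open ≡-Reasoning
    open import Data.Nat.Divisibility using (_∣_)
    instance _ = k !≢0
    P≡P′ : n P k ≡ n P′ k
    P≡P′ with k ≤ᵇ n | ≤⇒≤ᵇ k≤n
    ... | true | _ = refl

  choose-pos : ∀ t ℓ → ℓ ≤ t → 1 ≤ t C ℓ
  choose-pos t       zero    _         = ≤-refl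
  choose-pos (suc t) (suc ℓ) (s≤s ℓ≤t) =
    ≤-trans (choose-pos t ℓ ℓ≤t) (≤-trans (m≤m+n (t C ℓ) (t C suc ℓ))
                                          (≤-reflexive (nCk+nC[k+1]≡[n+1]C[k+1] t ℓ)))

  falling≤power : ∀ n k → n P′ k ≤ n ^ k
  falling≤power n zero    = ≤-refl
  falling≤power n (suc k) = *-mono-≤ (m∸n≤m n k) (falling≤power n k)

  triangle : ℕ → ℕ
  triangle zero    = 0
  triangle (suc j) = triangle j + j

  2*triangle≤square : ∀ j → 2 * triangle j ≤ j * j
  2*triangle≤square zero    = z≤n
  2*triangle≤square (suc j) = begin
    2 * (triangle j + j)       ≡⟨ *-distribˡ-+ 2 (triangle j) j ⟩
    2 * triangle j + 2 * j     ≤⟨ +-monoˡ-≤ (2 * j) (2*triangle≤square j) ⟩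
    j * j + 2 * j              ≤⟨ n≤1+n _ ⟩
    suc (j * j + 2 * j)        ≡⟨ square-suc j ⟩
    suc j * suc j              ∎
    where
    open ≤-Reasoning
    square-suc : ∀ j → suc (j * j + 2 * j) ≡ suc j * suc j
    square-suc = solve-∀

  -- One induction step of the Weierstrass inequality below, with c = k - j, F = k P′ j,
  -- X = k ^ j:  from  kX ≤ kF + sX  and  F ≤ X  infer  k(kX) ≤ k(cF) + (s + j)(kX).
  weierstrass-step : ∀ c j k F X s → c + j ≡ k → k * X ≤ k * F + s * X → F ≤ X →
    k * (k * X) ≤ k * (c * F) + (s + j) * (k * X)
  weierstrass-step c j .(c + j) F X s refl hyp F≤X = begin
    (c + j) * ((c + j) * X)                                    ≤⟨ *-monoʳ-≤ (c + j) hyp ⟩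
    (c + j) * ((c + j) * F + s * X)                            ≡⟨ expand c j F X s ⟩
    (c + j) * (c * F) + j * ((c + j) * F) + s * ((c + j) * X)
      ≤⟨ +-monoˡ-≤ (s * ((c + j) * X))
                   (+-monoʳ-≤ ((c + j) * (c * F)) (*-monoʳ-≤ j (*-monoʳ-≤ (c + j) F≤X))) ⟩
    (c + j) * (c * F) + j * ((c + j) * X) + s * ((c + j) * X)  ≡⟨ collect c j F X s ⟩
    (c + j) * (c * F) + (s + j) * ((c + j) * X)                ∎
    where
    open ≤-Reasoning
    expand : ∀ c j F X s → (c + j) * ((c + j) * F + s * X) ≡
                           (c + j) * (c * F) + j * ((c + j) * F) + s * ((c + j) * X)
    expand = solve-∀
    collect : ∀ c j F X s → (c + j) * (c * F) + j * ((c + j) * X) + s * ((c + j) * X) ≡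
                            (c + j) * (c * F) + (s + j) * ((c + j) * X)
    collect = solve-∀

  -- Weierstrass product inequality  ∏_{i<j} (1 - i/k) ≥ 1 - Σ_{i<j} i/k,  without denominators.
  weierstrass : ∀ k j → j ≤ k → k * k ^ j ≤ k * (k P′ j) + triangle j * k ^ j
  weierstrass k zero    _   = ≤-reflexive (sym (+-identityʳ _))
  weierstrass k (suc j) j<k =
    weierstrass-step (k ∸ j) j k (k P′ j) (k ^ j) (triangle j) (m∸n+n≡m (<⇒≤ j<k))
                     (weierstrass k j (<⇒≤ j<k)) (falling≤power k j)

  falling-large : ∀ k ℓ → 2 * ℓ * ℓ ≤ k → 3 * k ^ ℓ ≤ 4 * (k P′ ℓ)
  falling-large zero      zero _ = n≤1+n 3
  falling-large zero      (suc ℓ) ()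
  falling-large k@(suc _) ℓ 2ℓℓ≤k = *-cancelˡ-≤ k (+-cancelʳ-≤ (k * k ^ ℓ) _ _ (begin
    k * (3 * k ^ ℓ) + k * k ^ ℓ          ≡⟨ regroup k (k ^ ℓ) ⟩
    4 * (k * k ^ ℓ)                      ≤⟨ *-monoʳ-≤ 4 (weierstrass k ℓ ℓ≤k) ⟩
    4 * (k * F + triangle ℓ * k ^ ℓ)     ≡⟨ distribute k F (triangle ℓ) (k ^ ℓ) ⟩
    k * (4 * F) + 4 * triangle ℓ * k ^ ℓ ≤⟨ +-monoʳ-≤ _ (*-monoˡ-≤ (k ^ ℓ) 4triangle≤k) ⟩
    k * (4 * F) + k * k ^ ℓ              ∎))
    where
    open ≤-Reasoning
    F : ℕ
    F = k P′ ℓ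
    ℓ≤k : ℓ ≤ k
    ℓ≤k = ≤-trans (ℓ≤2ℓℓ ℓ) 2ℓℓ≤k
    regroup : ∀ k X → k * (3 * X) + k * X ≡ 4 * (k * X)
    regroup = solve-∀
    distribute : ∀ k F s X → 4 * (k * F + s * X) ≡ k * (4 * F) + 4 * s * X
    distribute = solve-∀
    4triangle≤k : 4 * triangle ℓ ≤ k
    4triangle≤k = begin
      4 * triangle ℓ        ≡⟨ *-assoc 2 2 (triangle ℓ) ⟩
      2 * (2 * triangle ℓ)  ≤⟨ *-monoʳ-≤ 2 (2*triangle≤square ℓ) ⟩
      2 * (ℓ * ℓ)           ≡⟨ sym (*-assoc 2 ℓ ℓ) ⟩
      2 * ℓ * ℓ             ≤⟨ 2ℓℓ≤k ⟩
      k                     ∎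

  choose-ratio : ∀ t k ℓ → 2 * ℓ * ℓ ≤ k → k ≤ t → 3 * (t C ℓ) * k ^ ℓ ≤ 4 * (k C ℓ) * t ^ ℓ
  choose-ratio t k ℓ 2ℓℓ≤k k≤t = *-cancelʳ-≤ _ _ (ℓ !) {{ℓ !≢0}} (begin
    3 * (t C ℓ) * k ^ ℓ * ℓ !     ≡⟨ regroup₁ (t C ℓ) (k ^ ℓ) (ℓ !) ⟩
    3 * k ^ ℓ * ((t C ℓ) * ℓ !)   ≡⟨ cong (3 * k ^ ℓ *_) (choose*factorial ℓ≤t) ⟩
    3 * k ^ ℓ * (t P′ ℓ)          ≤⟨ *-monoʳ-≤ (3 * k ^ ℓ) (falling≤power t ℓ) ⟩
    3 * k ^ ℓ * t ^ ℓ             ≤⟨ *-monoˡ-≤ (t ^ ℓ) (falling-large k ℓ 2ℓℓ≤k) ⟩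
    4 * (k P′ ℓ) * t ^ ℓ          ≡⟨ cong (λ u → 4 * u * t ^ ℓ) (sym (choose*factorial ℓ≤k)) ⟩
    4 * ((k C ℓ) * ℓ !) * t ^ ℓ   ≡⟨ regroup₂ (k C ℓ) (ℓ !) (t ^ ℓ) ⟩
    4 * (k C ℓ) * t ^ ℓ * ℓ !     ∎)
    where
    open ≤-Reasoning
    ℓ≤k : ℓ ≤ k
    ℓ≤k = ≤-trans (ℓ≤2ℓℓ ℓ) 2ℓℓ≤k
    ℓ≤t : ℓ ≤ t
    ℓ≤t = ≤-trans ℓ≤k k≤t
    regroup₁ : ∀ a b c → 3 * a * b * c ≡ 3 * b * (a * c)
    regroup₁ = solve-∀
    regroup₂ : ∀ a b c → 4 * (a * b) * c ≡ 4 * a * c * b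
    regroup₂ = solve-∀

module Decay where

  open import Data.Nat
  open import Data.Nat.Properties
  open import Data.Nat.DivMod using (_/_; _%_; m/n*n≤m; m≡m%n+[m/n]*n; m%n<n; /-monoˡ-≤; m*n/n≡m)
  open import Data.Nat.Tactic.RingSolver using (solve-∀)
  open import Data.Product using (_,_)
  open import Relation.Binary.PropositionalEquality

  ^-distribʳ-* : ∀ a b n → (a * b) ^ n ≡ a ^ n * b ^ n
  ^-distribʳ-* a b zero    = refl
  ^-distribʳ-* a b (suc n) = trans (cong (a * b *_) (^-distribʳ-* a b n)) (*-interchange a b _ _)
    where open import Algebra.Properties.CommutativeSemigroup *-commutativeSemigroup
            using () renaming (interchange to *-interchange)

  -- Twice the binomial expansion of (a + b)^(G+2), truncated after the quadratic term.
  binomial-second-order : ∀ G a b →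
    a ^ G * (2 * (a * a) + 2 * (2 + G) * (a * b) + (2 + G) * (1 + G) * (b * b))
      ≤ 2 * (a + b) ^ (2 + G)
  binomial-second-order zero    a b = ≤-reflexive (expand a b)
    where
    expand : ∀ a b → 1 * (2 * (a * a) + 2 * 2 * (a * b) + 2 * 1 * (b * b)) ≡
                     2 * ((a + b) * ((a + b) * 1))
    expand = solve-∀
  binomial-second-order (suc G) a b = begin
    a * a ^ G * (2 * (a * a) + 2 * (3 + G) * (a * b) + (3 + G) * (2 + G) * (b * b))
      ≤⟨ m≤m+n _ _ ⟩
    a * a ^ G * (2 * (a * a) + 2 * (3 + G) * (a * b) + (3 + G) * (2 + G) * (b * b))
      + a ^ G * ((2 + G) * (1 + G) * (b * (b * b)))
      ≡⟨ pascal G a b (a ^ G) ⟩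
    (a + b) * (a ^ G * (2 * (a * a) + 2 * (2 + G) * (a * b) + (2 + G) * (1 + G) * (b * b)))
      ≤⟨ *-monoʳ-≤ (a + b) (binomial-second-order G a b) ⟩
    (a + b) * (2 * (a + b) ^ (2 + G))
      ≡⟨ commute-2 (a + b) ((a + b) ^ (2 + G)) ⟩
    2 * (a + b) ^ (3 + G) ∎
    where
    open ≤-Reasoning
    pascal : ∀ G a b x →
      a * x * (2 * (a * a) + 2 * (3 + G) * (a * b) + (3 + G) * (2 + G) * (b * b))
        + x * ((2 + G) * (1 + G) * (b * (b * b)))
      ≡ (a + b) * (x * (2 * (a * a) + 2 * (2 + G) * (a * b) + (2 + G) * (1 + G) * (b * b)))
    pascal = solve-∀
    commute-2 : ∀ c y → c * (2 * y) ≡ 2 * (c * y)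
    commute-2 = solve-∀

  -- The estimate  8N² < 4(3+H)NK + (3+H)(2+H)K²  behind block-growth, in three steps with
  -- X = (3+H)K:  9N < 5X,  8N² < X² + 3NX,  and  X² + 3NX ≤ 4(3+H)NK + (3+H)(2+H)K².
  nine-fifths : ∀ H N K → 12 * N < 5 * (4 + H) * K → 9 * N < 5 * ((3 + H) * K)
  nine-fifths H N K hyp = *-cancelˡ-< 4 _ _ (begin-strict
    4 * (9 * N)                       ≡⟨ e₁ N ⟩
    3 * (12 * N)                      <⟨ *-monoʳ-< 3 hyp ⟩
    3 * (5 * (4 + H) * K)             ≡⟨ e₂ H K ⟩
    15 * X + 5 * (3 * K)              ≤⟨ +-monoʳ-≤ (15 * X) (*-monoʳ-≤ 5 3K≤X) ⟩
    15 * X + 5 * X                    ≡⟨ e₃ X ⟩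
    4 * (5 * X)                       ∎)
    where
    open ≤-Reasoning
    X : ℕ
    X = (3 + H) * K
    3K≤X : 3 * K ≤ X
    3K≤X = *-monoˡ-≤ K (m≤m+n 3 H)
    e₁ : ∀ N → 4 * (9 * N) ≡ 3 * (12 * N)
    e₁ = solve-∀
    e₂ : ∀ H K → 3 * (5 * (4 + H) * K) ≡ 15 * ((3 + H) * K) + 5 * (3 * K)
    e₂ = solve-∀
    e₃ : ∀ X → 15 * X + 5 * X ≡ 4 * (5 * X)
    e₃ = solve-∀

  square-estimate : ∀ N X → 1 ≤ N → 9 * N < 5 * X → 8 * (N * N) < X * X + 3 * N * X
  square-estimate N X 1≤N 9N<5X = *-cancelˡ-< 25 _ _ (begin-strict
    25 * (8 * (N * N))                   ≡⟨ e₁ N ⟩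
    200 * (N * N) + 0                    <⟨ +-monoʳ-< (200 * (N * N)) 0<16N² ⟩
    200 * (N * N) + 16 * (N * N)         ≡⟨ e₂ N ⟩
    9 * N * (9 * N) + 15 * N * (9 * N)
      ≤⟨ +-mono-≤ (*-mono-≤ 9N≤5X 9N≤5X) (*-monoʳ-≤ (15 * N) 9N≤5X) ⟩
    5 * X * (5 * X) + 15 * N * (5 * X)   ≡⟨ e₃ N X ⟩
    25 * (X * X + 3 * N * X)             ∎)
    where
    open ≤-Reasoning
    9N≤5X : 9 * N ≤ 5 * X
    9N≤5X = <⇒≤ 9N<5X
    0<16N² : 0 < 16 * (N * N)
    0<16N² = ≤-trans (s≤s z≤n) (*-monoʳ-≤ 16 (*-mono-≤ 1≤N 1≤N))
    e₁ : ∀ N → 25 * (8 * (N * N)) ≡ 200 * (N * N) + 0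
    e₁ = solve-∀
    e₂ : ∀ N → 200 * (N * N) + 16 * (N * N) ≡ 9 * N * (9 * N) + 15 * N * (9 * N)
    e₂ = solve-∀
    e₃ : ∀ N X → 5 * X * (5 * X) + 15 * N * (5 * X) ≡ 25 * (X * X + 3 * N * X)
    e₃ = solve-∀

  quadratic-estimate : ∀ H N K → 1 ≤ N → K ≤ N → 12 * N < 5 * (4 + H) * K →
    8 * (N * N) < 4 * (3 + H) * N * K + (3 + H) * (2 + H) * (K * K)
  quadratic-estimate H N K 1≤N K≤N hyp = begin-strict
    8 * (N * N)
      <⟨ square-estimate N X 1≤N (nine-fifths H N K hyp) ⟩
    X * X + 3 * N * X                                 ≡⟨ e₁ H N K ⟩
    (3 + H) * (2 + H) * (K * K) + X * K + 3 * N * X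
      ≤⟨ +-monoˡ-≤ (3 * N * X) (+-monoʳ-≤ _ (*-monoʳ-≤ X K≤N)) ⟩
    (3 + H) * (2 + H) * (K * K) + X * N + 3 * N * X   ≡⟨ e₂ H N K ⟩
    4 * (3 + H) * N * K + (3 + H) * (2 + H) * (K * K) ∎
    where
    open ≤-Reasoning
    X : ℕ
    X = (3 + H) * K
    e₁ : ∀ H N K → (3 + H) * K * ((3 + H) * K) + 3 * N * ((3 + H) * K) ≡
                   (3 + H) * (2 + H) * (K * K) + (3 + H) * K * K + 3 * N * ((3 + H) * K)
    e₁ = solve-∀
    e₂ : ∀ H N K → (3 + H) * (2 + H) * (K * K) + (3 + H) * K * N + 3 * N * ((3 + H) * K) ≡
                   4 * (3 + H) * N * K + (3 + H) * (2 + H) * (K * K)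
    e₂ = solve-∀

  block-growth : ∀ H N K → 1 ≤ N → K ≤ N → 12 * N < 5 * (4 + H) * K →
                 2 * (2 * N) ^ (3 + H) < (2 * N + K) ^ (3 + H)
  block-growth H (suc N′) K _ K≤N hyp = *-cancelˡ-< 2 _ _ (begin-strict
    2 * (2 * (2 * N) ^ (3 + H))                     ≡⟨ e₁ (2 * N) ((2 * N) ^ (1 + H)) ⟩
    (2 * N) ^ (1 + H) * (4 * ((2 * N) * (2 * N)))
      <⟨ *-monoʳ-< ((2 * N) ^ (1 + H)) {{m^n≢0 (2 * N) (1 + H)}} quadratic ⟩
    (2 * N) ^ (1 + H) * Q                           ≤⟨ binomial-second-order (1 + H) (2 * N) K ⟩
    2 * (2 * N + K) ^ (3 + H)                       ∎)
    where
    open ≤-Reasoning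
    N Q : ℕ
    N = suc N′
    Q = 2 * ((2 * N) * (2 * N)) + 2 * (3 + H) * ((2 * N) * K) + (3 + H) * (2 + H) * (K * K)
    e₁ : ∀ a x → 2 * (2 * (a * (a * x))) ≡ x * (4 * (a * a))
    e₁ = solve-∀
    quadratic : 4 * ((2 * N) * (2 * N)) < Q
    quadratic = begin-strict
      4 * ((2 * N) * (2 * N))                 ≡⟨ e₂ N ⟩
      2 * ((2 * N) * (2 * N)) + 8 * (N * N)
        <⟨ +-monoʳ-< _ (quadratic-estimate H N K (s≤s z≤n) K≤N hyp) ⟩
      2 * ((2 * N) * (2 * N)) + (4 * (3 + H) * N * K + (3 + H) * (2 + H) * (K * K))
        ≡⟨ e₃ H N K ⟩
      Q                                       ∎
      where
      e₂ : ∀ N → 4 * ((2 * N) * (2 * N)) ≡ 2 * ((2 * N) * (2 * N)) + 8 * (N * N)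
      e₂ = solve-∀
      e₃ : ∀ H N K →
        2 * ((2 * N) * (2 * N)) + (4 * (3 + H) * N * K + (3 + H) * (2 + H) * (K * K)) ≡
        2 * ((2 * N) * (2 * N)) + 2 * (3 + H) * ((2 * N) * K) + (3 + H) * (2 + H) * (K * K)
      e₃ = solve-∀

  -- If B = W + K and F steps of B ↦ B + K more than double B^F, then F steps of B ↦ W
  -- less than halve it, because W (B + K) = B² - K² ≤ B².
  block-halving : ∀ F W K B .{{_ : NonZero W}} → W + K ≡ B →
                  2 * B ^ F < (B + K) ^ F → W ^ F * 2 < B ^ F
  block-halving F W K B W+K≡B growth = *-cancelʳ-< (B ^ F) _ _ (begin-strict
    W ^ F * 2 * B ^ F         ≡⟨ *-assoc (W ^ F) 2 _ ⟩
    W ^ F * (2 * B ^ F)       <⟨ *-monoʳ-< (W ^ F) {{m^n≢0 W F}} growth ⟩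
    W ^ F * (B + K) ^ F       ≡⟨ sym (^-distribʳ-* W (B + K) F) ⟩
    (W * (B + K)) ^ F         ≤⟨ ^-monoˡ-≤ F difference-of-squares ⟩
    (B * B) ^ F               ≡⟨ ^-distribʳ-* B B F ⟩
    B ^ F * B ^ F             ∎)
    where
    open ≤-Reasoning
    difference-of-squares : W * (B + K) ≤ B * B
    difference-of-squares rewrite sym W+K≡B = begin
      W * (W + K + K)           ≤⟨ m≤m+n _ _ ⟩
      W * (W + K + K) + K * K   ≡⟨ e W K ⟩
      (W + K) * (W + K)         ∎
      where
      e : ∀ W K → W * (W + K + K) + K * K ≡ (W + K) * (W + K)
      e = solve-∀

  split-power : ∀ W F A r → W ^ (A * F + r) ≡ (W ^ F) ^ A * W ^ r
  split-power W F A r = begin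
    W ^ (A * F + r)       ≡⟨ ^-distribˡ-+-* W (A * F) r ⟩
    W ^ (A * F) * W ^ r   ≡⟨ cong (λ e → W ^ e * W ^ r) (*-comm A F) ⟩
    W ^ (F * A) * W ^ r   ≡⟨ cong (_* W ^ r) (sym (^-*-assoc W F A)) ⟩
    (W ^ F) ^ A * W ^ r   ∎
    where open ≡-Reasoning

  many-blocks : ∀ W B F A n .{{_ : NonZero W}} .{{_ : NonZero A}} → W ≤ B → W ^ F * 2 < B ^ F →
                A * F ≤ n → W ^ n * 2 ^ A < B ^ n
  many-blocks W B F A n W≤B block AF≤n with m≤n⇒∃[o]m+o≡n AF≤n
  ... | r , refl = begin-strict
    W ^ (A * F + r) * 2 ^ A         ≡⟨ cong (_* 2 ^ A) (split-power W F A r) ⟩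
    (W ^ F) ^ A * W ^ r * 2 ^ A     ≡⟨ e ((W ^ F) ^ A) (W ^ r) (2 ^ A) ⟩
    (W ^ F) ^ A * 2 ^ A * W ^ r     ≡⟨ cong (_* W ^ r) (sym (^-distribʳ-* (W ^ F) 2 A)) ⟩
    (W ^ F * 2) ^ A * W ^ r         <⟨ *-monoˡ-< (W ^ r) {{m^n≢0 W r}} (^-monoˡ-< A block) ⟩
    (B ^ F) ^ A * W ^ r             ≤⟨ *-monoʳ-≤ ((B ^ F) ^ A) (^-monoˡ-≤ r W≤B) ⟩
    (B ^ F) ^ A * B ^ r             ≡⟨ sym (split-power B F A r) ⟩
    B ^ (A * F + r)                 ∎
    where
    open ≤-Reasoning
    e : ∀ x y z → x * y * z ≡ x * z * y
    e = solve-∀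

  block-count : ∀ a b n M t F → 1 ≤ a → F * (5 * a) ≤ 16 * b →
                4 * b * M < n * a → 16 * b * t ≤ n * a → (M + t) * F ≤ n
  block-count a@(suc _) b n M t F _ FD≤E few many = *-cancelʳ-≤ _ _ (5 * a) (begin
    (M + t) * F * (5 * a)              ≡⟨ *-assoc (M + t) F _ ⟩
    (M + t) * (F * (5 * a))            ≤⟨ *-monoʳ-≤ (M + t) FD≤E ⟩
    (M + t) * (16 * b)                 ≡⟨ e₁ M t b ⟩
    4 * (4 * b * M) + 16 * b * t       ≤⟨ +-mono-≤ (*-monoʳ-≤ 4 (<⇒≤ few)) many ⟩
    4 * (n * a) + n * a                ≡⟨ e₂ n a ⟩
    n * (5 * a)                        ∎)
    where
    open ≤-Reasoning
    e₁ : ∀ M t b → (M + t) * (16 * b) ≡ 4 * (4 * b * M) + 16 * b * t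
    e₁ = solve-∀
    e₂ : ∀ n a → 4 * (n * a) + n * a ≡ n * (5 * a)
    e₂ = solve-∀

  block-long-enough : ∀ N K a b H → 1 ≤ N → 3 * N * a ≤ 4 * K * b →
                      16 * b < (4 + H) * (5 * a) → 12 * N < 5 * (4 + H) * K
  block-long-enough N@(suc _) K a b H _ ratio E<[F+1]D = *-cancelʳ-< (4 * b) _ _ (begin-strict
    12 * N * (4 * b)              ≡⟨ e₁ N b ⟩
    3 * N * (16 * b)              <⟨ *-monoʳ-< (3 * N) E<[F+1]D ⟩
    3 * N * ((4 + H) * (5 * a))   ≡⟨ e₂ N H a ⟩
    5 * (4 + H) * (3 * N * a)     ≤⟨ *-monoʳ-≤ (5 * (4 + H)) ratio ⟩
    5 * (4 + H) * (4 * K * b)     ≡⟨ e₃ H K b ⟩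
    5 * (4 + H) * K * (4 * b)     ∎)
    where
    open ≤-Reasoning
    e₁ : ∀ N b → 12 * N * (4 * b) ≡ 3 * N * (16 * b)
    e₁ = solve-∀
    e₂ : ∀ N H a → 3 * N * ((4 + H) * (5 * a)) ≡ 5 * (4 + H) * (3 * N * a)
    e₂ = solve-∀
    e₃ : ∀ H K b → 5 * (4 + H) * (4 * K * b) ≡ 5 * (4 + H) * K * (4 * b)
    e₃ = solve-∀

  floor-bracket : ∀ E D .{{_ : NonZero D}} → E < suc (E / D) * D
  floor-bracket E D = begin-strict
    E                   ≡⟨ m≡m%n+[m/n]*n E D ⟩
    E % D + E / D * D   <⟨ +-monoˡ-< (E / D * D) (m%n<n E D) ⟩
    D + E / D * D       ∎
    where open ≤-Reasoning

  halving-block : ∀ F W K N a b .{{_ : NonZero W}} → 3 ≤ F → W + K ≡ 2 * N → K ≤ N → 1 ≤ N →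
                  3 * N * a ≤ 4 * K * b → 16 * b < suc F * (5 * a) → W ^ F * 2 < (2 * N) ^ F
  halving-block F W K N a b 3≤F W+K≡2N K≤N 1≤N ratio long with m≤n⇒∃[o]m+o≡n 3≤F
  ... | H , refl = block-halving (3 + H) W K (2 * N) W+K≡2N
                     (block-growth H N K 1≤N K≤N (block-long-enough N K a b H 1≤N ratio long))

  -- Read N = t C ℓ, K = ∣Z∣ C ℓ, W = 2N − K,
  -- a = ∣Z∣^ℓ, b = t^ℓ: the weight (W / 2N)^n 2^M of at most M hits stays below 2^(-t) once
  -- n·a ≥ 16·b·t and 4·b·M < n·a.  The n draws are cut into M + t blocks of ⌊16b / 5a⌋ ≥ 3
  -- draws, each of which halves the weight.
  decay : ∀ W K N a b t n M → W + K ≡ 2 * N → K ≤ N → 1 ≤ N → 3 * N * a ≤ 4 * K * b →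
          1 ≤ a → a ≤ b → 1 ≤ t → 4 * b * M < n * a → 16 * b * t ≤ n * a →
          W ^ n * 2 ^ (M + t) < (2 * N) ^ n
  decay W K N a@(suc _) b t n M W+K≡2N K≤N 1≤N ratio 1≤a a≤b 1≤t few many =
    many-blocks W (2 * N) F (M + t) n W≤2N
      (halving-block F W K N a b 3≤F W+K≡2N K≤N 1≤N ratio (floor-bracket (16 * b) (5 * a)))
      (block-count a b n M t F 1≤a (m/n*n≤m (16 * b) (5 * a)) few many)
    where
    F : ℕ
    F = 16 * b / (5 * a)
    N≤W : N ≤ W
    N≤W = +-cancelʳ-≤ K N W (begin
      N + K      ≤⟨ +-monoʳ-≤ N K≤N ⟩
      N + N      ≡⟨ cong (N +_) (sym (+-identityʳ N)) ⟩
      2 * N      ≡⟨ sym W+K≡2N ⟩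
      W + K      ∎)
      where open ≤-Reasoning
    instance
      W≢0 : NonZero W
      W≢0 = >-nonZero (≤-trans 1≤N N≤W)
      M+t≢0 : NonZero (M + t)
      M+t≢0 = >-nonZero (≤-trans 1≤t (m≤n+m t M))
    W≤2N : W ≤ 2 * N
    W≤2N = ≤-trans (m≤m+n W K) (≤-reflexive W+K≡2N)
    3≤F : 3 ≤ F
    3≤F = begin
      3                       ≡⟨ sym (m*n/n≡m 3 (5 * a)) ⟩
      3 * (5 * a) / (5 * a)   ≤⟨ /-monoˡ-≤ (5 * a) 15a≤16b ⟩
      16 * b / (5 * a)        ∎
      where
      open ≤-Reasoning
      15a≤16b : 3 * (5 * a) ≤ 16 * b
      15a≤16b = ≤-trans (≤-reflexive (sym (*-assoc 3 5 a)))
                        (≤-trans (*-monoʳ-≤ 15 a≤b) (*-monoˡ-≤ b (n≤1+n 15)))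

  -- The threshold M = ⌊(x - 1)/d⌋ is the largest c with d·c < x.
  threshold-below : ∀ x d .{{_ : NonZero d}} → 1 ≤ x → d * ((x ∸ 1) / d) < x
  threshold-below (suc x) d _ = s≤s (≤-trans (≤-reflexive (*-comm d (x / d))) (m/n*n≤m x d))

  threshold-largest : ∀ x d c .{{_ : NonZero d}} → d * c < x → c ≤ (x ∸ 1) / d
  threshold-largest (suc x) d c (s≤s dc≤x) = begin
    c               ≡⟨ sym (m*n/n≡m c d) ⟩
    c * d / d       ≤⟨ /-monoˡ-≤ d (≤-trans (≤-reflexive (*-comm c d)) dc≤x) ⟩
    x / d           ∎
    where open ≤-Reasoning

module Counting (t ℓ n : ℕ) (1≤ℓ : 1 ℕ.≤ ℓ) (ℓ≤t : ℓ ℕ.≤ t) where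

  open import Data.Nat
  open import Data.Nat.Properties
  open import Data.Nat.Combinatorics using (_C_)
  open import Data.Vec using (Vec; lookup)
  open import Data.Fin.Subset using (Subset; ∣_∣)
  open import Data.Fin.Subset.Properties using (∣p∣≤n)
  open import Data.Product using (Σ; _×_; _,_)
  open import Relation.Nullary using (Dec; yes; no; _×-dec_)
  open import Relation.Binary.PropositionalEquality
  open import Defs using (containedIn)
  open SubsetSums
  open SequenceSums t ℓ
  open BinomialEstimate using (ℓ≤2ℓℓ; choose-pos; choose-ratio)
  open Decay using (decay; threshold-below; threshold-largest; ^-distribʳ-*)

  -- The sets Z the theorem speaks about: large, and with n draws giving 16t expected hits.
  Relevant : Subset t → Set
  Relevant Z = 2 * ℓ * ℓ ≤ ∣ Z ∣ × 16 * t ^ ℓ * t ≤ n * ∣ Z ∣ ^ ℓ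

  relevant? : ∀ Z → Dec (Relevant Z)
  relevant? Z = (2 * ℓ * ℓ ≤? ∣ Z ∣) ×-dec (16 * t ^ ℓ * t ≤? n * ∣ Z ∣ ^ ℓ)

  Fails : Vec (Subset t) n → Subset t → Set
  Fails v Z = Relevant Z × 4 * t ^ ℓ * hits Z v < n * ∣ Z ∣ ^ ℓ

  low? : (v : Vec (Subset t) n) (Z : Subset t) → Dec (4 * t ^ ℓ * hits Z v < n * ∣ Z ∣ ^ ℓ)
  low? v Z = 4 * t ^ ℓ * hits Z v <? n * ∣ Z ∣ ^ ℓ

  fails? : (v : Vec (Subset t) n) (Z : Subset t) → Dec (Fails v Z)
  fails? v Z = relevant? Z ×-dec low? v Z

  1≤t : 1 ≤ t
  1≤t = ≤-trans 1≤ℓ ℓ≤t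

  instance
    t≢0 : NonZero t
    t≢0 = >-nonZero 1≤t

  -- At a relevant Z, failing sequences form less than a 2^(-t) fraction of all sequences:
  -- the lower-tail bound with M = ⌊(n∣Z∣^ℓ - 1) / 4t^ℓ⌋ combined with decay and choose-ratio.
  rarely-fails-at : ∀ Z (r : Relevant Z) →
    2 ^ t * sumSeq n (λ v → indicator (yes r ×-dec low? v Z)) < (t C ℓ) ^ n
  rarely-fails-at Z r@(2ℓℓ≤k , many) = *-cancelˡ-< (2 ^ n) _ _ (begin-strict
    2 ^ n * (2 ^ t * failing)        ≡⟨ x∙yz≈y∙xz (2 ^ n) (2 ^ t) failing ⟩
    2 ^ t * (2 ^ n * failing)        ≤⟨ *-monoʳ-≤ (2 ^ t) (lower-tail n M Z fails-here? few-hits) ⟩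
    2 ^ t * (2 ^ M * W ^ n)          ≡⟨ x∙yz≈zy∙x (2 ^ t) (2 ^ M) (W ^ n) ⟩
    W ^ n * 2 ^ M * 2 ^ t            ≡⟨ *-assoc (W ^ n) (2 ^ M) (2 ^ t) ⟩
    W ^ n * (2 ^ M * 2 ^ t)          ≡⟨ cong (W ^ n *_) (sym (^-distribˡ-+-* 2 M t)) ⟩
    W ^ n * 2 ^ (M + t)              <⟨ decay W K N (k ^ ℓ) (t ^ ℓ) t n M (penalty-total t ℓ Z)
                                          (choose-⊆-≤ t ℓ Z) 1≤N
                                          (choose-ratio t k ℓ 2ℓℓ≤k (∣p∣≤n Z))
                                          1≤kˡ (^-monoˡ-≤ ℓ (∣p∣≤n Z)) 1≤t
                                          (threshold-below (n * k ^ ℓ) (4 * t ^ ℓ) 1≤nkˡ) many ⟩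
    (2 * N) ^ n                      ≡⟨ ^-distribʳ-* 2 N n ⟩
    2 ^ n * N ^ n                    ∎)
    where
    open ≤-Reasoning
    open import Algebra.Properties.CommutativeSemigroup *-commutativeSemigroup
      using (x∙yz≈y∙xz; x∙yz≈zy∙x)
    k N K W failing : ℕ
    k = ∣ Z ∣
    N = t C ℓ
    K = k C ℓ
    W = sumChoose t ℓ (penalty Z)
    fails-here? : (v : Vec (Subset t) n) → Dec (Fails v Z)
    fails-here? v = yes r ×-dec low? v Z
    failing = sumSeq n (λ v → indicator (fails-here? v))
    instance
      4tˡ≢0 : NonZero (4 * t ^ ℓ)
      4tˡ≢0 = >-nonZero (≤-trans (m^n>0 t ℓ) (m≤n*m (t ^ ℓ) 4))
      k≢0 : NonZero k
      k≢0 = >-nonZero (≤-trans 1≤ℓ (≤-trans (ℓ≤2ℓℓ ℓ) 2ℓℓ≤k))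
    M : ℕ
    M = (n * k ^ ℓ ∸ 1) / (4 * t ^ ℓ)
    few-hits : ∀ v → Fails v Z → hits Z v ≤ M
    few-hits v (_ , low) = threshold-largest (n * k ^ ℓ) (4 * t ^ ℓ) (hits Z v) low
    1≤N : 1 ≤ N
    1≤N = choose-pos t ℓ ℓ≤t
    1≤kˡ : 1 ≤ k ^ ℓ
    1≤kˡ = m^n>0 k ℓ
    1≤nkˡ : 1 ≤ n * k ^ ℓ
    1≤nkˡ = ≤-trans (*-mono-≤ (*-mono-≤ {1} {16} (s≤s z≤n) (m^n>0 t ℓ)) 1≤t) many

  -- The same bound at every Z: at an irrelevant Z nothing fails.
  rarely-fails : ∀ Z → 2 ^ t * sumSeq n (λ v → indicator (fails? v Z)) < (t C ℓ) ^ n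
  rarely-fails Z = rarely-fails-when (relevant? Z)
    where
    rarely-fails-when : (r? : Dec (Relevant Z)) →
      2 ^ t * sumSeq n (λ v → indicator (r? ×-dec low? v Z)) < (t C ℓ) ^ n
    rarely-fails-when (yes r) = rarely-fails-at Z r
    rarely-fails-when (no _)  = begin-strict
      2 ^ t * sumSeq n (λ _ → 0)   ≡⟨ cong (2 ^ t *_) (sumSeq-* n 0 (λ _ → 0)) ⟩
      2 ^ t * 0                    ≡⟨ *-zeroʳ (2 ^ t) ⟩
      0                            <⟨ m^n>0 (t C ℓ) {{>-nonZero (choose-pos t ℓ ℓ≤t)}} n ⟩
      (t C ℓ) ^ n                  ∎
      where open ≤-Reasoning

  -- Union bound over the 2^t sets Z: on average a sequence fails at fewer than one Z.
  rarely-fails-anywhere : sumSeq n (λ v → sumAll t (λ Z → indicator (fails? v Z))) < (t C ℓ) ^ n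
  rarely-fails-anywhere = subst (_< (t C ℓ) ^ n) (sym (sumSeq-sumAll n t _))
                                (sumAll-union t _ _ rarely-fails)

  good-sequence : Σ (Vec (Subset t) n) λ v → Valid v ×
    (∀ Z → Relevant Z → n * ∣ Z ∣ ^ ℓ ≤ 4 * t ^ ℓ * ∣ containedIn (lookup v) Z ∣)
  good-sequence with vanishes-somewhere n _ rarely-fails-anywhere
  ... | v , valid , no-failure = v , valid , enough-hits
    where
    enough-hits : ∀ Z → Relevant Z → n * ∣ Z ∣ ^ ℓ ≤ 4 * t ^ ℓ * ∣ containedIn (lookup v) Z ∣
    enough-hits Z r rewrite hits-containedIn Z v = ≮⇒≥ λ low →
      indicator-zero (fails? v Z) (sumAll-zero t _ no-failure Z) (r , low)

module RationalBridge where

  open import Data.Nat as ℕ using (ℕ; zero; suc)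
  open import Data.Integer as ℤ using (+_; -[1+_]; +≤+; -≤+)
  import Data.Integer.Properties as ℤP
  import Data.Integer.DivMod as ℤD
  open import Data.Rational using (mkℚ; 0ℚ; 1ℚ; _/_; _≤_; _*_; ↥_; ↧_; *≤*; -_; floor; ceiling;
                                   Positive; nonNegative)
  open import Data.Rational.Properties
  import Data.Nat.Coprimality as Coprimality
  open import Relation.Binary.PropositionalEquality
  open import Defs using (toℚ; _^_)

  toℚ-normal : ∀ n → toℚ n ≡ mkℚ (+ n) 0 (Coprimality.sym (Coprimality.1-coprimeTo n))
  toℚ-normal n = normalize-coprime _

  toℚ-* : ∀ a b → toℚ (a ℕ.* b) ≡ toℚ a * toℚ b
  toℚ-* a b = trans (cong (_/ 1) (ℤP.pos-* a b)) (sym (cong₂ _*_ (toℚ-normal a) (toℚ-normal b)))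

  toℚ-^ : ∀ a k → toℚ (a ℕ.^ k) ≡ toℚ a ^ k
  toℚ-^ a zero    = refl
  toℚ-^ a (suc k) = trans (toℚ-* a (a ℕ.^ k)) (cong (toℚ a *_) (toℚ-^ a k))

  toℚ-mono-≤ : ∀ {a b} → a ℕ.≤ b → toℚ a ≤ toℚ b
  toℚ-mono-≤ {a} {b} a≤b = subst₂ _≤_ (sym (toℚ-normal a)) (sym (toℚ-normal b))
    (*≤* (subst₂ ℤ._≤_ (sym (ℤP.*-identityʳ _)) (sym (ℤP.*-identityʳ _)) (+≤+ a≤b)))

  toℚ-cancel-≤ : ∀ {a b} → toℚ a ≤ toℚ b → a ℕ.≤ b
  toℚ-cancel-≤ {a} {b} le = ℤP.drop‿+≤+ (subst₂ ℤ._≤_ (ℤP.*-identityʳ _) (ℤP.*-identityʳ _)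
                              (drop-*≤* (subst₂ _≤_ (toℚ-normal a) (toℚ-normal b) le)))

  toℚ-nonNeg : ∀ m → 0ℚ ≤ toℚ m
  toℚ-nonNeg m = toℚ-mono-≤ {0} {m} ℕ.z≤n

  toℚ-pos : ∀ m → ℕ.NonZero m → Positive (toℚ m)
  toℚ-pos (suc m) _ = subst Positive (sym (toℚ-normal (suc m))) _

  ^-distribʳ-* : ∀ x y k → (x * y) ^ k ≡ x ^ k * y ^ k
  ^-distribʳ-* x y zero    = refl
  ^-distribʳ-* x y (suc k) = trans (cong (x * y *_) (^-distribʳ-* x y k)) (*-interchange x y _ _)
    where
    open import Algebra.Bundles using (CommutativeRing)
    open import Algebra.Properties.CommutativeSemigroup
      (CommutativeRing.*-commutativeSemigroup +-*-commutativeRing)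
      using () renaming (interchange to *-interchange)

  ^-nonNeg : ∀ x k → 0ℚ ≤ x → 0ℚ ≤ x ^ k
  ^-nonNeg x zero    _   = <⇒≤ (positive⁻¹ 1ℚ)
  ^-nonNeg x (suc k) 0≤x = nonNegative⁻¹ _
    {{nonNeg*nonNeg⇒nonNeg x {{nonNegative 0≤x}} (x ^ k) {{nonNegative (^-nonNeg x k 0≤x)}}}}

  ^-monoˡ-≤ : ∀ k {x y} → 0ℚ ≤ x → x ≤ y → x ^ k ≤ y ^ k
  ^-monoˡ-≤ zero    _   _   = ≤-refl
  ^-monoˡ-≤ (suc k) {x} {y} 0≤x x≤y =
    ≤-trans (*-monoˡ-≤-nonNeg x {{nonNegative 0≤x}} (^-monoˡ-≤ k 0≤x x≤y))
            (*-monoʳ-≤-nonNeg (y ^ k) {{nonNegative (^-nonNeg y k (≤-trans 0≤x x≤y))}} x≤y)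

  ≤-∣ceiling∣ : ∀ q → q ≤ toℚ ℤ.∣ ceiling q ∣
  ≤-∣ceiling∣ q@(mkℚ _ _ _) = subst (q ≤_) (sym (toℚ-normal ℤ.∣ ⌈q⌉ ∣))
    (*≤* (subst (ℤ._≤ + ℤ.∣ ⌈q⌉ ∣ ℤ.* ↧ q) (sym (ℤP.*-identityʳ (↥ q)))
                (ℤP.≤-trans ↥q≤⌈q⌉↧q (ℤP.*-monoʳ-≤-nonNeg (↧ q) (≤-∣∣ ⌈q⌉)))))
    where
    ⌈q⌉ : ℤ.ℤ
    ⌈q⌉ = ceiling q
    ≤-∣∣ : ∀ i → i ℤ.≤ + ℤ.∣ i ∣
    ≤-∣∣ (+ n)    = ℤP.≤-refl
    ≤-∣∣ -[1+ n ] = -≤+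
    floor-bound : ∀ p → floor p ℤ.* ↧ p ℤ.≤ ↥ p
    floor-bound p@(mkℚ _ _ _) = ℤD.[n/d]*d≤n (↥ p) (↧ p)
    floor≤ : floor (- q) ℤ.* ↧ q ℤ.≤ ℤ.- ↥ q
    floor≤ = subst₂ (λ d u → floor (- q) ℤ.* d ℤ.≤ u) (↧-neg q) (↥-neg q) (floor-bound (- q))
    ↥q≤⌈q⌉↧q : ↥ q ℤ.≤ ⌈q⌉ ℤ.* ↧ q
    ↥q≤⌈q⌉↧q = subst₂ ℤ._≤_ (ℤP.neg-involutive (↥ q)) (ℤP.neg-distribˡ-* (floor (- q)) (↧ q))
                 (ℤP.neg-mono-≤ floor≤)

open import Defs
open import Data.Rational as ℚ using (ℚ; 0ℚ; 1ℚ; _<_; _≤_; _*_; _÷_; >-nonZero)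
open import Data.Fin using (Fin)
open import Data.Fin.Subset using (Subset; ∣_∣)
open import Data.Product using (Σ; _×_; _,_; proj₁; proj₂)
open import Relation.Binary.PropositionalEquality
  using (_≡_; refl; sym; trans; cong; subst; module ≡-Reasoning)
open import Data.Vec using (Vec; lookup)
import Data.Nat.Properties as ℕP
import Data.Rational.Properties as ℚP
open import Data.Rational.Solver using (module +-*-Solver)
open RationalBridge

ζt≥2ℓ² : ∀ ℓ ζ (0<ζ : 0ℚ < ζ) → let instance _ = >-nonZero 0<ζ in
         toℚ (2 ℕ.* ℓ ℕ.* ℓ) ≤ ζ * toℚ (tOf ℓ ζ)
ζt≥2ℓ² ℓ ζ 0<ζ = ℚP.≤-trans (ℚP.≤-reflexive (sym cancel))
                   (ℚP.*-monoˡ-≤-nonNeg ζ {{ℚ.nonNegative (ℚP.<⇒≤ 0<ζ)}} (≤-∣ceiling∣ (two ÷ ζ)))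
  where
  instance _ = >-nonZero 0<ζ
  two : ℚ
  two = toℚ (2 ℕ.* ℓ ℕ.* ℓ)
  open +-*-Solver
  cancel : ζ * (two ÷ ζ) ≡ two
  cancel = trans (solve 3 (λ a b c → a :* (b :* c) := b :* (a :* c)) refl ζ two (ℚ.1/ ζ))
                 (trans (cong (two *_) (ℚP.*-inverseʳ ζ)) (ℚP.*-identityʳ two))

scaled-count : ∀ n ℓ k t z → toℚ k ≡ z * toℚ t →
               toℚ (n ℕ.* k ℕ.^ ℓ) ≡ toℚ n * z ^ ℓ * toℚ t ^ ℓ
scaled-count n ℓ k t z k≡zt = begin
  toℚ (n ℕ.* k ℕ.^ ℓ)          ≡⟨ trans (toℚ-* n (k ℕ.^ ℓ)) (cong (toℚ n *_) (toℚ-^ k ℓ)) ⟩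
  toℚ n * toℚ k ^ ℓ            ≡⟨ cong (λ x → toℚ n * x ^ ℓ) k≡zt ⟩
  toℚ n * (z * toℚ t) ^ ℓ      ≡⟨ cong (toℚ n *_) (^-distribʳ-* z (toℚ t) ℓ) ⟩
  toℚ n * (z ^ ℓ * toℚ t ^ ℓ)  ≡⟨ sym (ℚP.*-assoc (toℚ n) (z ^ ℓ) _) ⟩
  toℚ n * z ^ ℓ * toℚ t ^ ℓ    ∎
  where open ≡-Reasoning

relevant-of-density : ∀ ℓ n t k ζ z → 0ℚ ≤ ζ → toℚ (2 ℕ.* ℓ ℕ.* ℓ) ≤ ζ * toℚ t →
  toℚ 16 * toℚ t ≤ toℚ n * ζ ^ ℓ → toℚ k ≡ z * toℚ t → ζ ≤ z →
  2 ℕ.* ℓ ℕ.* ℓ ℕ.≤ k × 16 ℕ.* t ℕ.^ ℓ ℕ.* t ℕ.≤ n ℕ.* k ℕ.^ ℓ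
relevant-of-density ℓ n t k ζ z 0≤ζ 2ℓℓ≤ζt many k≡zt ζ≤z =
  toℚ-cancel-≤ (begin
    toℚ (2 ℕ.* ℓ ℕ.* ℓ)  ≤⟨ 2ℓℓ≤ζt ⟩
    ζ * T                ≤⟨ ℚP.*-monoʳ-≤-nonNeg T ζ≤z ⟩
    z * T                ≡⟨ sym k≡zt ⟩
    toℚ k                ∎) ,
  toℚ-cancel-≤ (begin
    toℚ (16 ℕ.* t ℕ.^ ℓ ℕ.* t)   ≡⟨ expand ⟩
    toℚ 16 * T * T ^ ℓ            ≤⟨ ℚP.*-monoʳ-≤-nonNeg (T ^ ℓ) many ⟩
    toℚ n * ζ ^ ℓ * T ^ ℓ
      ≤⟨ ℚP.*-monoʳ-≤-nonNeg (T ^ ℓ) (ℚP.*-monoˡ-≤-nonNeg (toℚ n) (^-monoˡ-≤ ℓ 0≤ζ ζ≤z)) ⟩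
    toℚ n * z ^ ℓ * T ^ ℓ         ≡⟨ sym (scaled-count n ℓ k t z k≡zt) ⟩
    toℚ (n ℕ.* k ℕ.^ ℓ)           ∎)
  where
  open ℚP.≤-Reasoning
  open +-*-Solver
  T : ℚ
  T = toℚ t
  instance
    T≥0 : ℚ.NonNegative T
    T≥0 = ℚ.nonNegative (toℚ-nonNeg t)
    Tˡ≥0 : ℚ.NonNegative (T ^ ℓ)
    Tˡ≥0 = ℚ.nonNegative (^-nonNeg T ℓ (toℚ-nonNeg t))
    n≥0 : ℚ.NonNegative (toℚ n)
    n≥0 = ℚ.nonNegative (toℚ-nonNeg n)
  expand : toℚ (16 ℕ.* t ℕ.^ ℓ ℕ.* t) ≡ toℚ 16 * T * T ^ ℓ
  expand = trans (toℚ-* (16 ℕ.* t ℕ.^ ℓ) t)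
    (trans (cong (_* T) (trans (toℚ-* 16 (t ℕ.^ ℓ)) (cong (toℚ 16 *_) (toℚ-^ t ℓ))))
           (solve 3 (λ a b c → (a :* b) :* c := (a :* c) :* b) refl (toℚ 16) (T ^ ℓ) T))

density-count : ∀ ℓ n t k c z → ℕ.NonZero t → toℚ k ≡ z * toℚ t →
  n ℕ.* k ℕ.^ ℓ ℕ.≤ 4 ℕ.* t ℕ.^ ℓ ℕ.* c → (toℚ n * z ^ ℓ) ÷ toℚ 4 ≤ toℚ c
density-count ℓ n t k c z t≢0 k≡zt enough = begin
  (toℚ n * z ^ ℓ) ÷ toℚ 4        ≤⟨ ℚP.*-monoʳ-≤-nonNeg (ℚ.1/ toℚ 4) nzˡ≤4c ⟩
  toℚ 4 * toℚ c * ℚ.1/ toℚ 4     ≡⟨ quarter ⟩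
  toℚ c                          ∎
  where
  open ℚP.≤-Reasoning
  open +-*-Solver
  T : ℚ
  T = toℚ t
  instance
    Tˡ>0 : ℚ.Positive (T ^ ℓ)
    Tˡ>0 = subst ℚ.Positive (toℚ-^ t ℓ)
             (toℚ-pos (t ℕ.^ ℓ) (ℕP.m^n≢0 t ℓ {{t≢0}}))
  nzˡ≤4c : toℚ n * z ^ ℓ ≤ toℚ 4 * toℚ c
  nzˡ≤4c = ℚP.*-cancelʳ-≤-pos (T ^ ℓ) (begin
    toℚ n * z ^ ℓ * T ^ ℓ        ≡⟨ sym (scaled-count n ℓ k t z k≡zt) ⟩
    toℚ (n ℕ.* k ℕ.^ ℓ)          ≤⟨ toℚ-mono-≤ enough ⟩
    toℚ (4 ℕ.* t ℕ.^ ℓ ℕ.* c)    ≡⟨ expand ⟩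
    toℚ 4 * toℚ c * T ^ ℓ        ∎)
    where
    expand : toℚ (4 ℕ.* t ℕ.^ ℓ ℕ.* c) ≡ toℚ 4 * toℚ c * T ^ ℓ
    expand = trans (toℚ-* (4 ℕ.* t ℕ.^ ℓ) c)
      (trans (cong (_* toℚ c) (trans (toℚ-* 4 (t ℕ.^ ℓ)) (cong (toℚ 4 *_) (toℚ-^ t ℓ))))
             (solve 3 (λ a b c → (a :* b) :* c := (a :* c) :* b) refl (toℚ 4) (T ^ ℓ) (toℚ c)))
  quarter : toℚ 4 * toℚ c * ℚ.1/ toℚ 4 ≡ toℚ c
  quarter = trans (solve 3 (λ a b c → (a :* b) :* c := b :* (a :* c)) refl
                          (toℚ 4) (toℚ c) (ℚ.1/ toℚ 4))
                  (trans (cong (toℚ c *_) (ℚP.*-inverseʳ (toℚ 4))) (ℚP.*-identityʳ (toℚ c)))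

lemma4p3 : (ℓ n : ℕ) → ℓ ≥ 3 → (ζ : ℚ) → (0<ζ : 0ℚ < ζ) → ζ ≤ 1ℚ →
    let instance _ = >-nonZero 0<ζ
        t = tOf ℓ ζ
    in toℚ 16 * toℚ t ≤ toℚ n * ζ ^ ℓ →
       Σ (Fin n → Subset t) λ L →
         ((i : Fin n) → ∣ L i ∣ ≡ ℓ) ×
         ((Z : Subset t) (z : ℚ) → toℚ ∣ Z ∣ ≡ z * toℚ t → ζ ≤ z →
            (toℚ n * z ^ ℓ) ÷ toℚ 4 ≤ toℚ ∣ containedIn L Z ∣)
lemma4p3 ℓ n ℓ≥3 ζ 0<ζ ζ≤1 many = lookup v , valid , dense-sets-hit
  where
  instance _ = >-nonZero 0<ζ
  t : ℕ
  t = tOf ℓ ζ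
  1≤ℓ : 1 ℕ.≤ ℓ
  1≤ℓ = ℕP.≤-trans (ℕ.s≤s ℕ.z≤n) ℓ≥3
  ℓ≤t : ℓ ℕ.≤ t
  ℓ≤t = ℕP.≤-trans (BinomialEstimate.ℓ≤2ℓℓ ℓ) (toℚ-cancel-≤ (begin
    toℚ (2 ℕ.* ℓ ℕ.* ℓ)   ≤⟨ ζt≥2ℓ² ℓ ζ 0<ζ ⟩
    ζ * toℚ t             ≤⟨ ℚP.*-monoʳ-≤-nonNeg (toℚ t) {{ℚ.nonNegative (toℚ-nonNeg t)}} ζ≤1 ⟩
    1ℚ * toℚ t            ≡⟨ ℚP.*-identityˡ (toℚ t) ⟩
    toℚ t                 ∎))
    where open ℚP.≤-Reasoning
  t≢0 : ℕ.NonZero t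
  t≢0 = ℕ.>-nonZero (ℕP.≤-trans 1≤ℓ ℓ≤t)
  open Counting t ℓ n 1≤ℓ ℓ≤t using (good-sequence; Relevant)
  v : Vec (Subset t) n
  v = proj₁ good-sequence
  valid : SequenceSums.Valid t ℓ v
  valid = proj₁ (proj₂ good-sequence)
  enough : ∀ Z → Relevant Z → n ℕ.* ∣ Z ∣ ℕ.^ ℓ ℕ.≤ 4 ℕ.* t ℕ.^ ℓ ℕ.* ∣ containedIn (lookup v) Z ∣
  enough = proj₂ (proj₂ good-sequence)
  dense-sets-hit : (Z : Subset t) (z : ℚ) → toℚ ∣ Z ∣ ≡ z * toℚ t → ζ ≤ z →
                   (toℚ n * z ^ ℓ) ÷ toℚ 4 ≤ toℚ ∣ containedIn (lookup v) Z ∣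
  dense-sets-hit Z z ∣Z∣≡zt ζ≤z = density-count ℓ n t ∣ Z ∣ _ z t≢0 ∣Z∣≡zt (enough Z
    (relevant-of-density ℓ n t ∣ Z ∣ ζ z (ℚP.<⇒≤ 0<ζ) (ζt≥2ℓ² ℓ ζ 0<ζ) many ∣Z∣≡zt ζ≤z))
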